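{- Let $G$ be a multigraph, $f : V(G) \to \mathbb{Z}_{\ge 2}$ a function, and $d$ an integer. If $\max\{\Delta_f(G), a(G)\} \le d$, then $G$ has an orientation $D$ such that $\max\{\Delta^-(D), \Delta^+_{f-1}(D), a(\overline{D})\} \le d$.
   Context: A multigraph may have parallel edges but no loops. The arboricity $a(G)$ of a multigraph is the minimum number of colors in an edge-coloring in which every color class is a forest. $\Delta_f(G) = \max_{v \in V(G)} \lceil d(v)/f(v) \rceil$, with $d(v)$ the degree of $v$ (counting parallel edges). For a directed multigraph $D$: $\Delta^-(D)$ is the maximum indegree $d^-(v)$ over vertices $v$; $\Delta^+_{f-1}(D) = \max_{v \in V(D)} \lceil d^+(v)/(f(v)-1) \rceil$, where $d^+(v)$ is the outdegree; $\overline{D}$ is the underlying undirected multigraph. An orientation of $G$ is a directed multigraph obtained by directing each edge of $G$, so that $\overline{D} = G$. -}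

module Defs where

open import Data.Nat using (ℕ; zero; suc; _+_; _≤_; _⊔_; _∸_)
open import Data.Nat.DivMod using (_/_)
open import Data.Bool using (Bool; true; false; _∨_)
open import Data.Fin using (Fin; zero; suc; fromℕ; inject₁; _≟_)
open import Data.List using (List; map; foldr; allFin)
open import Data.Nat.ListAction using (sum)
open import Data.Product using (Σ; _×_; _,_; proj₁; proj₂; swap)
open import Data.Sum using (_⊎_)
open import Relation.Nullary using (¬_)
open import Relation.Nullary.Decidable using (⌊_⌋)
open import Relation.Binary.PropositionalEquality using (_≡_; _≢_)
open import Function.Definitions using (Injective)

-- A multigraph on vertex set Fin n with m edges: edge e has endpoints ends e.
-- (Also used for directed multigraphs: arcs e = (tail, head).)
Ends : ℕ → ℕ → Set
Ends n m = Fin m → Fin n × Fin n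

Loopless : ∀ {n m} → Ends n m → Set
Loopless G = ∀ e → proj₁ (G e) ≢ proj₂ (G e)

ind : Bool → ℕ
ind true  = 1
ind false = 0

degree : ∀ {n m} → Ends n m → Fin n → ℕ
degree {m = m} G v =
  sum (map (λ e → ind (⌊ proj₁ (G e) ≟ v ⌋ ∨ ⌊ proj₂ (G e) ≟ v ⌋)) (allFin m))

outdeg : ∀ {n m} → Ends n m → Fin n → ℕ
outdeg {m = m} D v = sum (map (λ e → ind ⌊ proj₁ (D e) ≟ v ⌋) (allFin m))

indeg : ∀ {n m} → Ends n m → Fin n → ℕ
indeg {m = m} D v = sum (map (λ e → ind ⌊ proj₂ (D e) ≟ v ⌋) (allFin m))

maxOver : ∀ {n} → (Fin n → ℕ) → ℕ
maxOver {n} g = foldr _⊔_ 0 (map g (allFin n))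

-- ⌈a / b⌉ for b ≥ 1 (value at b = 0 is a dummy 0, never used)
ceilDiv : ℕ → ℕ → ℕ
ceilDiv a zero    = 0
ceilDiv a (suc b) = (a + b) / suc b

Δf : ∀ {n m} → Ends n m → (Fin n → ℕ) → ℕ
Δf G f = maxOver (λ v → ceilDiv (degree G v) (f v))

Δin : ∀ {n m} → Ends n m → ℕ
Δin D = maxOver (indeg D)

Δout-f-1 : ∀ {n m} → Ends n m → (Fin n → ℕ) → ℕ
Δout-f-1 D f = maxOver (λ v → ceilDiv (outdeg D v) (f v ∸ 1))

Joins : ∀ {n m} → Ends n m → Fin m → Fin n → Fin n → Set
Joins G e u v = (proj₁ (G e) ≡ u × proj₂ (G e) ≡ v) ⊎ (proj₁ (G e) ≡ v × proj₂ (G e) ≡ u)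

-- A cycle (of length k ≥ 2) in the sub-multigraph with edge set P:
-- distinct vertices vs 0, …, vs (k-1), with vs k = vs 0, and distinct edges
-- es i ∈ P joining vs i and vs (i+1).
Cycle : ∀ {n m} → Ends n m → (Fin m → Set) → Set
Cycle {n} {m} G P =
  Σ ℕ λ k → 2 ≤ k ×
  Σ (Fin (suc k) → Fin n) λ vs →
  Σ (Fin k → Fin m) λ es →
    vs zero ≡ vs (fromℕ k) ×
    Injective _≡_ _≡_ (λ i → vs (inject₁ i)) ×
    Injective _≡_ _≡_ es ×
    (∀ i → P (es i) × Joins G (es i) (vs (inject₁ i)) (vs (suc i)))

IsForest : ∀ {n m} → Ends n m → (Fin m → Set) → Set
IsForest G P = ¬ Cycle G P

-- a(G) ≤ k : there is an edge-colouring with k colours whose colour classes are forests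
ArboricityAtMost : ∀ {n m} → Ends n m → ℕ → Set
ArboricityAtMost {m = m} G k =
  Σ (Fin m → Fin k) λ c → ∀ (i : Fin k) → IsForest G (λ e → c e ≡ i)

-- D is an orientation of G: each arc is the corresponding edge of G, directed one way
-- (so the underlying multigraph of D, i.e. D read as undirected, is G).
IsOrientation : ∀ {n m} → Ends n m → Ends n m → Set
IsOrientation G D = ∀ e → (D e ≡ G e) ⊎ (D e ≡ swap (G e))

{-# OPTIONS --safe #-}
module Submission where

-- Orient every colour class, a forest, so that each vertex receives at most one of its arcs;
-- gluing the classes gives an orientation with all indegrees at most d.  Reverse it: all
-- outdegrees are now at most d, and d(v) ≤ d f(v) leaves room d (f(v) − 1) for the indegree.
-- While some vertex v exceeds that room, reverse a directed trail ending at v that starts at a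
-- vertex with spare room.  This lowers the total excess, and outdegrees stay at most d because
-- only v gains an out-arc while losing an in-arc, and v has more than d (f(v) − 1) in-arcs.
-- If there is no such trail, the set S of vertices with a trail to v receives arcs only from S,
-- so  Σ_S d (f − 1) < Σ_S d⁻ ≤ Σ_S d⁺ ≤ d |S| ≤ Σ_S d (f − 1).  The same trail reversal orients a
-- forest: there such an S would give each of its vertices an in-arc from S, and walking
-- backwards along these arcs closes a cycle.  Reversing once more yields indegrees ≤ d and
-- outdegrees ≤ d (f − 1), and the underlying multigraph, hence the colouring, is unchanged.

open import Defs
open import Data.Bool using (Bool; true; false; T; _∧_; _∨_; if_then_else_)
import Data.Bool.Properties as Bool
open import Data.Bool.Properties using (T-∨; T-∧)
open import Data.Empty using (⊥-elim)
open import Data.Fin using (Fin; zero; suc; _≟_; toℕ; fromℕ; fromℕ<; inject₁)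
open import Data.Fin.Properties
  using (all?; any?; ¬∀⟶∃¬; ¬∀⟶∃¬-smallest; pigeonhole;
         toℕ-inject; toℕ-inject₁; toℕ-fromℕ; toℕ-fromℕ<; toℕ<n; toℕ-injective)
open import Data.List using (List; []; _∷_; allFin; tabulate)
import Data.List as List
open import Data.List.Membership.Propositional using (_∉_)
open import Data.List.Membership.Propositional.Properties using (∈-allFin)
open import Data.List.Properties using (map-tabulate; foldr-preservesᵇ; foldr-forcesᵇ)
open import Data.List.Relation.Unary.All as All using (All; []; _∷_)
open import Data.List.Relation.Unary.All.Properties using (map⁺; map⁻; tabulate⁺)
open import Data.List.Relation.Unary.Any using (here; there)
open import Data.Nat using (ℕ; zero; suc; _+_; _*_; _∸_; _≤_; _<_; z≤n; s≤s)
open import Data.Nat.DivMod using (_/_; m<n*o⇒m/o<n; m*n/n≡m; /-monoˡ-≤)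
open import Data.Nat.ListAction using () renaming (sum to listSum)
open import Data.Nat.Properties hiding (_≟_)
open import Algebra.Properties.CommutativeSemigroup +-commutativeSemigroup using (xy∙z≈xz∙y)
open import Algebra.Properties.CommutativeSemigroup *-commutativeSemigroup using (x∙yz≈z∙yx)
open import Algebra.Properties.Semiring.Sum +-*-semiring
  using (sum; sum-cong-≗; ∑-distrib-+; ∑-comm; *-distribˡ-sum)
open import Data.Product using (Σ; ∃; _×_; _,_; proj₁; proj₂; swap)
open import Data.Sum using (_⊎_; inj₁; inj₂; [_,_])
import Data.Sum
open import Function using (_∘_; id)
open import Function.Bundles using (Equivalence)
open import Function.Definitions using (Injective)
open import Relation.Binary.Definitions using (tri<; tri≈; tri>)
open import Relation.Binary.PropositionalEquality
  using (_≡_; _≢_; refl; sym; trans; cong; cong₂; subst; subst₂; module ≡-Reasoning)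
open import Relation.Nullary using (¬_; Dec; yes; no)
open import Relation.Nullary.Decidable
  using (⌊_⌋; ⌊⌋-map′; T?; _×-dec_; ¬?; map′; toWitness; fromWitness; decidable-stable)
open import Relation.Unary using (Decidable)

δ : ∀ {n} → Fin n → Fin n → ℕ
δ y x = ind ⌊ y ≟ x ⌋

δ-refl : ∀ {n} (x : Fin n) → δ x x ≡ 1
δ-refl x with x ≟ x
... | yes _   = refl
... | no x≢x = ⊥-elim (x≢x refl)

δ-≢ : ∀ {n} {y x : Fin n} → y ≢ x → δ y x ≡ 0
δ-≢ {y = y} {x} y≢x with y ≟ x
... | yes y≡x = ⊥-elim (y≢x y≡x)
... | no _    = refl

sum-allFin : ∀ {k} (g : Fin k → ℕ) → listSum (List.map g (allFin k)) ≡ sum g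
sum-allFin g = trans (cong listSum (map-tabulate id g)) (sum-tabulate g)
  where
  sum-tabulate : ∀ {k} (g : Fin k → ℕ) → listSum (tabulate g) ≡ sum g
  sum-tabulate {zero} g = refl
  sum-tabulate {suc k} g = cong (g zero +_) (sum-tabulate (g ∘ suc))

sum-const : ∀ k c → sum {k} (λ _ → c) ≡ k * c
sum-const zero c = refl
sum-const (suc k) c = cong (c +_) (sum-const k c)

sum-mono-≤ : ∀ {k} {g h : Fin k → ℕ} → (∀ i → g i ≤ h i) → sum g ≤ sum h
sum-mono-≤ {zero} g≤h = z≤n
sum-mono-≤ {suc k} g≤h = +-mono-≤ (g≤h zero) (sum-mono-≤ (g≤h ∘ suc))

sum-mono-< : ∀ {k} {g h : Fin k → ℕ} → (∀ i → g i ≤ h i) → ∀ j → g j < h j → sum g < sum h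
sum-mono-< g≤h zero    lt = +-mono-<-≤ lt (sum-mono-≤ (g≤h ∘ suc))
sum-mono-< g≤h (suc j) lt = +-mono-≤-< (g≤h zero) (sum-mono-< (g≤h ∘ suc) j lt)

sum-ind-positive : ∀ {k} (p : Fin k → Bool) → 0 < sum (ind ∘ p) → ∃ (T ∘ p)
sum-ind-positive {suc k} p pos with p zero in p₀
... | true  = zero , subst T (sym p₀) _
... | false = let i , pᵢ = sum-ind-positive (p ∘ suc) pos in suc i , pᵢ

ind-∧ : ∀ a b → ind (a ∧ b) ≡ ind a * ind b
ind-∧ true  b = sym (+-identityʳ (ind b))
ind-∧ false b = refl

sum-δ : ∀ {k} (y : Fin k) (g : Fin k → ℕ) → sum (λ x → δ y x * g x) ≡ g y
sum-δ {suc k} zero    g = trans (cong₂ _+_ (*-identityˡ (g zero)) (trans (sum-const k 0) (*-zeroʳ k))) (+-identityʳ _)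
sum-δ {suc k} (suc y) g =
  trans (sum-cong-≗ (λ x → cong (_* g (suc x)) (δ-suc y x))) (sum-δ y (g ∘ suc))
  where
  δ-suc : ∀ {k} (y x : Fin k) → δ (suc y) (suc x) ≡ δ y x
  δ-suc y x = cong ind (⌊⌋-map′ _ _ (y ≟ x))

sum-shift : ∀ {k} {g h : Fin k → ℕ} (i : Fin k) {c c′ : ℕ} →
  (∀ j → g j + δ i j * c ≡ h j + δ i j * c′) → sum g + c ≡ sum h + c′
sum-shift {g = g} {h} i {c} {c′} pointwise = begin
  sum g + c                              ≡⟨ cong (sum g +_) (sum-δ i (λ _ → c)) ⟨
  sum g + sum (λ j → δ i j * c)          ≡⟨ ∑-distrib-+ g _ ⟨
  sum (λ j → g j + δ i j * c)            ≡⟨ sum-cong-≗ pointwise ⟩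
  sum (λ j → h j + δ i j * c′)           ≡⟨ ∑-distrib-+ h _ ⟩
  sum h + sum (λ j → δ i j * c′)         ≡⟨ cong (sum h +_) (sum-δ i (λ _ → c′)) ⟩
  sum h + c′                             ∎
  where open ≡-Reasoning

record UnitMoved {n} (a b : Fin n → ℕ) (v w : Fin n) : Set where
  field
    at-source : suc (a v) ≡ b v
    at-target : a w ≡ suc (b w)
    elsewhere : ∀ y → y ≢ v → y ≢ w → a y ≡ b y

δ-balance⇒unitMoved : ∀ {n} {a b : Fin n → ℕ} {v w} → w ≢ v → (∀ y → a y + δ v y ≡ b y + δ w y) →
  UnitMoved a b v w
δ-balance⇒unitMoved {a = a} {b} {v} {w} w≢v balanced =
  record { at-source = at-v ; at-target = at-w ; elsewhere = elsewhere }
  where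
  open ≡-Reasoning
  at-v : suc (a v) ≡ b v
  at-v = begin
    suc (a v)      ≡⟨ +-comm 1 (a v) ⟩
    a v + 1        ≡⟨ cong (a v +_) (δ-refl v) ⟨
    a v + δ v v    ≡⟨ balanced v ⟩
    b v + δ w v    ≡⟨ cong (b v +_) (δ-≢ w≢v) ⟩
    b v + 0        ≡⟨ +-identityʳ (b v) ⟩
    b v            ∎
  at-w : a w ≡ suc (b w)
  at-w = begin
    a w            ≡⟨ +-identityʳ (a w) ⟨
    a w + 0        ≡⟨ cong (a w +_) (δ-≢ (w≢v ∘ sym)) ⟨
    a w + δ v w    ≡⟨ balanced w ⟩
    b w + δ w w    ≡⟨ cong (b w +_) (δ-refl w) ⟩
    b w + 1        ≡⟨ +-comm (b w) 1 ⟩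
    suc (b w)      ∎
  elsewhere : ∀ y → y ≢ v → y ≢ w → a y ≡ b y
  elsewhere y y≢v y≢w = +-cancelʳ-≡ 0 (a y) (b y) (begin
    a y + 0        ≡⟨ cong (a y +_) (δ-≢ (y≢v ∘ sym)) ⟨
    a y + δ v y    ≡⟨ balanced y ⟩
    b y + δ w y    ≡⟨ cong (b y +_) (δ-≢ (y≢w ∘ sym)) ⟩
    b y + 0        ∎)

maxOver≤⇒≤ : ∀ {n} (g : Fin n → ℕ) {d} → maxOver g ≤ d → ∀ v → g v ≤ d
maxOver≤⇒≤ g max≤d v =
  All.lookup (map⁻ (foldr-forcesᵇ (λ x y le → m⊔n≤o⇒m≤o x y le , m⊔n≤o⇒n≤o x y le) 0 _ max≤d))
             (∈-allFin v)

≤⇒maxOver≤ : ∀ {n} (g : Fin n → ℕ) {d} → (∀ v → g v ≤ d) → maxOver g ≤ d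
≤⇒maxOver≤ g {d} g≤d = foldr-preservesᵇ {P = _≤ d} ⊔-lub z≤n (map⁺ (tabulate⁺ g≤d))

a≤d*b⇒ceilDiv≤d : ∀ {a b d} → 0 < b → a ≤ d * b → ceilDiv a b ≤ d
a≤d*b⇒ceilDiv≤d {a} {suc b} {d} _ a≤d*b =
  ≤-pred (m<n*o⇒m/o<n (subst (a + b <_) (+-comm (d * suc b) (suc b)) (+-mono-≤-< a≤d*b (n<1+n b))))

ceilDiv≤d⇒a≤d*b : ∀ {a b d} → 0 < b → ceilDiv a b ≤ d → a ≤ d * b
ceilDiv≤d⇒a≤d*b {a} {suc b} {d} _ ceil≤d = ≮⇒≥ λ d*b<a → 1+n≰n (≤-trans (1+d≤ceil d*b<a) ceil≤d)
  where
  open ≤-Reasoning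
  1+d≤ceil : d * suc b < a → suc d ≤ (a + b) / suc b
  1+d≤ceil d*b<a = begin
    suc d                       ≡⟨ m*n/n≡m (suc d) (suc b) ⟨
    suc d * suc b / suc b       ≤⟨ /-monoˡ-≤ (suc b) [1+d]b≤a+b ⟩
    (a + b) / suc b             ∎
    where
    [1+d]b≤a+b : suc d * suc b ≤ a + b
    [1+d]b≤a+b = begin
      suc (b + d * suc b)       ≡⟨ +-suc b (d * suc b) ⟨
      b + suc (d * suc b)       ≤⟨ +-monoʳ-≤ b d*b<a ⟩
      b + a                     ≡⟨ +-comm b a ⟩
      a + b                     ∎

-- Degrees of orientations

arcCount : ∀ {n m} → (Fin n × Fin n → Fin n) → (Fin m → Bool) → Ends n m → Fin n → ℕ
arcCount end P D x = sum λ e → ind (P e ∧ ⌊ end (D e) ≟ x ⌋)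

indegIn outdegIn : ∀ {n m} → (Fin m → Bool) → Ends n m → Fin n → ℕ
indegIn  = arcCount proj₂
outdegIn = arcCount proj₁

degreeIn : ∀ {n m} → (Fin m → Bool) → Ends n m → Fin n → ℕ
degreeIn P G x = sum λ e → ind (P e ∧ (⌊ proj₁ (G e) ≟ x ⌋ ∨ ⌊ proj₂ (G e) ≟ x ⌋))

allEdges : ∀ {m} → Fin m → Bool
allEdges _ = true

indeg≡indegIn : ∀ {n m} (D : Ends n m) x → indeg D x ≡ indegIn allEdges D x
indeg≡indegIn D x = sum-allFin (λ e → ind ⌊ proj₂ (D e) ≟ x ⌋)

outdeg≡outdegIn : ∀ {n m} (D : Ends n m) x → outdeg D x ≡ outdegIn allEdges D x
outdeg≡outdegIn D x = sum-allFin (λ e → ind ⌊ proj₁ (D e) ≟ x ⌋)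

degree≡degreeIn : ∀ {n m} (G : Ends n m) x → degree G x ≡ degreeIn allEdges G x
degree≡degreeIn G x = sum-allFin (λ e → ind (⌊ proj₁ (G e) ≟ x ⌋ ∨ ⌊ proj₂ (G e) ≟ x ⌋))

indegIn+outdegIn≡degreeIn : ∀ {n m} {G D : Ends n m} → Loopless G → IsOrientation G D →
  ∀ P x → indegIn P D x + outdegIn P D x ≡ degreeIn P G x
indegIn+outdegIn≡degreeIn {G = G} {D} loopless orient P x =
  trans (sym (∑-distrib-+ (λ e → ind (P e ∧ ⌊ proj₂ (D e) ≟ x ⌋)) _)) (sum-cong-≗ arc)
  where
  ind-∨ : ∀ {y z} → y ≢ z → ind (⌊ y ≟ x ⌋ ∨ ⌊ z ≟ x ⌋) ≡ δ y x + δ z x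
  ind-∨ {y} {z} y≢z with y ≟ x | z ≟ x
  ... | yes refl | yes refl = ⊥-elim (y≢z refl)
  ... | yes _    | no _     = refl
  ... | no _     | yes _    = refl
  ... | no _     | no _     = refl
  arc : ∀ e → ind (P e ∧ ⌊ proj₂ (D e) ≟ x ⌋) + ind (P e ∧ ⌊ proj₁ (D e) ≟ x ⌋)
            ≡ ind (P e ∧ (⌊ proj₁ (G e) ≟ x ⌋ ∨ ⌊ proj₂ (G e) ≟ x ⌋))
  arc e with P e | D e | orient e
  ... | false | _ | _        = refl
  ... | true  | _ | inj₁ refl = sym (trans (ind-∨ (loopless e)) (+-comm (δ (proj₁ (G e)) x) _))
  ... | true  | _ | inj₂ refl = sym (ind-∨ (loopless e))

outdegIn≤degreeIn : ∀ {n m} {G D : Ends n m} → Loopless G → IsOrientation G D →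
  ∀ P x → outdegIn P D x ≤ degreeIn P G x
outdegIn≤degreeIn loopless orient P x =
  ≤-trans (m≤n+m _ _) (≤-reflexive (indegIn+outdegIn≡degreeIn loopless orient P x))

sum-over-set-arcCount : ∀ {n m} end (P : Fin m → Bool) (D : Ends n m) (S : Fin n → Bool) →
  sum (λ x → ind (S x) * arcCount end P D x) ≡ sum (λ e → ind (P e ∧ S (end (D e))))
sum-over-set-arcCount end P D S = begin
  sum (λ x → ind (S x) * sum (λ e → ind (P e ∧ ⌊ end (D e) ≟ x ⌋)))
    ≡⟨ sum-cong-≗ (λ x → *-distribˡ-sum (ind (S x)) (λ e → ind (P e ∧ ⌊ end (D e) ≟ x ⌋))) ⟩
  sum (λ x → sum (λ e → ind (S x) * ind (P e ∧ ⌊ end (D e) ≟ x ⌋)))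
    ≡⟨ ∑-comm (λ x e → ind (S x) * ind (P e ∧ ⌊ end (D e) ≟ x ⌋)) ⟩
  sum (λ e → sum (λ x → ind (S x) * ind (P e ∧ ⌊ end (D e) ≟ x ⌋)))
    ≡⟨ sum-cong-≗ (λ e → sum-cong-≗ (λ x →
         trans (cong (ind (S x) *_) (ind-∧ (P e) _)) (x∙yz≈z∙yx (ind (S x)) (ind (P e)) _))) ⟩
  sum (λ e → sum (λ x → δ (end (D e)) x * (ind (P e) * ind (S x))))
    ≡⟨ sum-cong-≗ (λ e → trans (sum-δ (end (D e)) _) (sym (ind-∧ (P e) _))) ⟩
  sum (λ e → ind (P e ∧ S (end (D e)))) ∎
  where open ≡-Reasoning

reverse : ∀ {n m} → Ends n m → Ends n m
reverse D e = swap (D e)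

reverse-orientation : ∀ {n m} {G D : Ends n m} → IsOrientation G D → IsOrientation G (reverse D)
reverse-orientation orient e with orient e
... | inj₁ D≡G     = inj₂ (cong swap D≡G)
... | inj₂ D≡swapG = inj₁ (cong swap D≡swapG)

orientation-joins : ∀ {n m} {G D : Ends n m} → IsOrientation G D → ∀ e {u w} → Joins D e u w → Joins G e u w
orientation-joins {D = D} orient e joins with D e | orient e
... | _ | inj₁ refl = joins
... | _ | inj₂ refl = Data.Sum.swap (Data.Sum.map swap swap joins)

arc-joins : ∀ {n m} {G D : Ends n m} → IsOrientation G D → ∀ e → Joins G e (proj₂ (D e)) (proj₁ (D e))
arc-joins orient e = orientation-joins orient e (inj₂ (refl , refl))

orientation-loopless : ∀ {n m} {G D : Ends n m} → Loopless G → IsOrientation G D → Loopless D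
orientation-loopless {D = D} loopless orient e with D e | orient e
... | _ | inj₁ refl = loopless e
... | _ | inj₂ refl = loopless e ∘ sym

cycle-map : ∀ {n m} {G H : Ends n m} {P Q : Fin m → Set} → (∀ {e} → P e → Q e) →
  (∀ e {u w} → Joins G e u w → Joins H e u w) → Cycle G P → Cycle H Q
cycle-map P⇒Q G⇒H (k , 2≤k , vs , es , closed , vs-inj , es-inj , along) =
  k , 2≤k , vs , es , closed , vs-inj , es-inj , λ i → P⇒Q (proj₁ (along i)) , G⇒H (es i) (proj₂ (along i))

orientation-arboricity : ∀ {n m} {G D : Ends n m} {k} → IsOrientation G D →
  ArboricityAtMost G k → ArboricityAtMost D k
orientation-arboricity orient (colour , forest) =
  colour , λ i → forest i ∘ cycle-map {P = λ e → colour e ≡ i} id (orientation-joins orient)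

-- Reversing trails

flipArc : ∀ {n m} → Fin m → Ends n m → Ends n m
flipArc e₀ D e = if ⌊ e ≟ e₀ ⌋ then swap (D e) else D e

flipArc-≢ : ∀ {n m} {e₀ e} (D : Ends n m) → e ≢ e₀ → flipArc e₀ D e ≡ D e
flipArc-≢ {e₀ = e₀} {e} D e≢e₀ with e ≟ e₀
... | yes e≡e₀ = ⊥-elim (e≢e₀ e≡e₀)
... | no _     = refl

flipArc-orientation : ∀ {n m} {G D : Ends n m} e₀ → IsOrientation G D → IsOrientation G (flipArc e₀ D)
flipArc-orientation e₀ orient e with ⌊ e ≟ e₀ ⌋
... | false = orient e
... | true  = reverse-orientation orient e

arcCount-flipArc : ∀ {n m} end (P : Fin m → Bool) (D : Ends n m) {e₀} → T (P e₀) → ∀ x →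
  arcCount end P (flipArc e₀ D) x + δ (end (D e₀)) x ≡ arcCount end P D x + δ (end (swap (D e₀))) x
arcCount-flipArc end P D {e₀} Pe₀ x = sum-shift e₀ (arc Pe₀)
  where
  arc : T (P e₀) → ∀ e → ind (P e ∧ ⌊ end (flipArc e₀ D e) ≟ x ⌋) + δ e₀ e * δ (end (D e₀)) x
            ≡ ind (P e ∧ ⌊ end (D e) ≟ x ⌋) + δ e₀ e * δ (end (swap (D e₀))) x
  arc Pe₀ e with e ≟ e₀ | e₀ ≟ e
  ... | no _     | no _     = refl
  ... | no e≢e₀  | yes e₀≡e = ⊥-elim (e≢e₀ (sym e₀≡e))
  ... | yes refl | no e₀≢e₀ = ⊥-elim (e₀≢e₀ refl)
  ... | yes refl | yes _ with P e₀
  ... | true = swap-summands (δ (end (swap (D e₀))) x) (δ (end (D e₀)) x)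
    where
    swap-summands : ∀ a b → a + (b + 0) ≡ b + (a + 0)
    swap-summands a b rewrite +-identityʳ a | +-identityʳ b = +-comm a b

module Trails {n m : ℕ} (P : Fin m → Bool) where

  Trail : Ends n m → Fin n → Fin n → List (Fin m) → Set
  Trail D x v []       = x ≡ v
  Trail D x v (e ∷ es) = T (P e) × proj₁ (D e) ≡ x × e ∉ es × Trail D (proj₂ (D e)) v es

  trail-flipArc : ∀ {D x v e₀} es → e₀ ∉ es → Trail D x v es → Trail (flipArc e₀ D) x v es
  trail-flipArc []       _   trail = trail
  trail-flipArc {D} {e₀ = e₀} (e ∷ es) e₀∉ (Pe , tail≡x , e∉es , trail)
    rewrite flipArc-≢ D (λ e≡e₀ → e₀∉ (here (sym e≡e₀))) =
    Pe , tail≡x , e∉es , trail-flipArc es (e₀∉ ∘ there) trail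

  reverseAlong : List (Fin m) → Ends n m → Ends n m
  reverseAlong []       D = D
  reverseAlong (e ∷ es) D = reverseAlong es (flipArc e D)

  reverseAlong-orientation : ∀ {G D} es → IsOrientation G D → IsOrientation G (reverseAlong es D)
  reverseAlong-orientation []       orient = orient
  reverseAlong-orientation (e ∷ es) orient = reverseAlong-orientation es (flipArc-orientation e orient)

  reverseAlong-degrees : ∀ {D x v} es → Trail D x v es → ∀ y →
    indegIn P (reverseAlong es D) y + δ v y ≡ indegIn P D y + δ x y ×
    outdegIn P (reverseAlong es D) y + δ x y ≡ outdegIn P D y + δ v y
  reverseAlong-degrees [] refl y = refl , refl
  reverseAlong-degrees {D} {v = v} (e ∷ es) (Pe , refl , e∉es , trail) y =
    trans (proj₁ rest) (arcCount-flipArc proj₂ P D Pe y) ,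
    chain (outdegIn P (reverseAlong es D₁) y) (outdegIn P D₁ y) (outdegIn P D y)
          (proj₂ rest) (arcCount-flipArc proj₁ P D Pe y)
    where
    D₁ : Ends n m
    D₁ = flipArc e D
    rest : indegIn P (reverseAlong es D₁) y + δ v y ≡ indegIn P D₁ y + δ (proj₂ (D e)) y ×
           outdegIn P (reverseAlong es D₁) y + δ (proj₂ (D e)) y ≡ outdegIn P D₁ y + δ v y
    rest = reverseAlong-degrees es (trail-flipArc es e∉es trail) y
    chain : ∀ a b c {u v x} → a + u ≡ b + v → b + x ≡ c + u → a + x ≡ c + v
    chain a b c {u} {v} {x} a+u≡b+v b+x≡c+u = +-cancelʳ-≡ u (a + x) (c + v) (begin
      a + x + u ≡⟨ xy∙z≈xz∙y a x u ⟩
      a + u + x ≡⟨ cong (_+ x) a+u≡b+v ⟩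
      b + v + x ≡⟨ xy∙z≈xz∙y b v x ⟩
      b + x + v ≡⟨ cong (_+ v) b+x≡c+u ⟩
      c + u + v ≡⟨ xy∙z≈xz∙y c u v ⟩
      c + v + u ∎)
      where open ≡-Reasoning

-- Backward reachability

chain-stabilises : ∀ {n} (R : ℕ → Fin n → Bool) → (∀ k x → T (R k x) → T (R (suc k) x)) →
  ∃ λ k → ∀ x → R (suc k) x ≡ R k x
chain-stabilises {n} R increasing =
  [ id , (λ 1+n≤size → ⊥-elim (1+n≰n (≤-trans 1+n≤size (size≤n (suc n))))) ] (grows (suc n))
  where
  size : ℕ → ℕ
  size k = sum (ind ∘ R k)

  size≤n : ∀ k → size k ≤ n
  size≤n k = ≤-trans (sum-mono-≤ (λ x → ind≤1 (R k x))) (≤-reflexive (trans (sum-const n 1) (*-identityʳ n)))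
    where
    ind≤1 : ∀ b → ind b ≤ 1
    ind≤1 true  = ≤-refl
    ind≤1 false = z≤n

  ind-increasing : ∀ k x → ind (R k x) ≤ ind (R (suc k) x)
  ind-increasing k x with R k x | R (suc k) x | increasing k x
  ... | false | _     | _  = z≤n
  ... | true  | true  | _  = ≤-refl
  ... | true  | false | up = ⊥-elim (up _)

  ind-grows : ∀ k x → R (suc k) x ≢ R k x → ind (R k x) < ind (R (suc k) x)
  ind-grows k x changed with R k x | R (suc k) x | increasing k x
  ... | false | false | _  = ⊥-elim (changed refl)
  ... | false | true  | _  = s≤s z≤n
  ... | true  | true  | _  = ⊥-elim (changed refl)
  ... | true  | false | up = ⊥-elim (up _)

  grows : ∀ k → (∃ λ j → ∀ x → R (suc j) x ≡ R j x) ⊎ k ≤ size k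
  grows zero    = inj₂ z≤n
  grows (suc k) with grows k
  ... | inj₁ stable = inj₁ stable
  ... | inj₂ k≤size with all? (λ x → R (suc k) x Bool.≟ R k x)
  ... | yes stable  = inj₁ (k , stable)
  ... | no unstable =
    let x , changed = ¬∀⟶∃¬ n _ (λ x → R (suc k) x Bool.≟ R k x) unstable
    in inj₂ (≤-trans (s≤s k≤size) (sum-mono-< (ind-increasing k) x (ind-grows k x changed)))

module BackwardReach {n m : ℕ} (P : Fin m → Bool) (D : Ends n m) where
  open Trails {n} P

  BackClosed : (Fin n → Bool) → Set
  BackClosed S = ∀ e → T (P e) → T (S (proj₂ (D e))) → T (S (proj₁ (D e)))

  closed⇒indegIn≤outdegIn : ∀ {S} → BackClosed S →
    sum (λ x → ind (S x) * indegIn P D x) ≤ sum (λ x → ind (S x) * outdegIn P D x)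
  closed⇒indegIn≤outdegIn {S} closed = begin
    sum (λ x → ind (S x) * indegIn P D x)       ≡⟨ sum-over-set-arcCount proj₂ P D S ⟩
    sum (λ e → ind (P e ∧ S (proj₂ (D e))))     ≤⟨ sum-mono-≤ arc ⟩
    sum (λ e → ind (P e ∧ S (proj₁ (D e))))     ≡⟨ sum-over-set-arcCount proj₁ P D S ⟨
    sum (λ x → ind (S x) * outdegIn P D x)      ∎
    where
    open ≤-Reasoning
    arc : ∀ e → ind (P e ∧ S (proj₂ (D e))) ≤ ind (P e ∧ S (proj₁ (D e)))
    arc e with P e | S (proj₂ (D e)) | S (proj₁ (D e)) | closed e
    ... | false | _     | _     | _ = z≤n
    ... | true  | false | _     | _ = z≤n
    ... | true  | true  | true  | _ = ≤-refl
    ... | true  | true  | false | tail∉ = ⊥-elim (tail∉ _ _)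

  arc-into? : (S : Fin n → Bool) (x : Fin n) (e : Fin m) →
    Dec (T (P e) × proj₁ (D e) ≡ x × T (S (proj₂ (D e))))
  arc-into? S x e = T? (P e) ×-dec proj₁ (D e) ≟ x ×-dec T? (S (proj₂ (D e)))

  reach : Fin n → ℕ → Fin n → Bool
  reach v zero    x = ⌊ x ≟ v ⌋
  reach v (suc k) x = reach v k x ∨ ⌊ any? (arc-into? (reach v k) x) ⌋

  reach-suc : ∀ v k {x} → T (reach v k x) → T (reach v (suc k) x)
  reach-suc v k r = Equivalence.from T-∨ (inj₁ r)

  reach-self : ∀ v k → T (reach v k v)
  reach-self v zero    = fromWitness refl
  reach-self v (suc k) = reach-suc v k (reach-self v k)

  reach-closed : ∀ v k → (∀ x → reach v (suc k) x ≡ reach v k x) → BackClosed (reach v k)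
  reach-closed v k stable e Pe head∈ = subst T (stable (proj₁ (D e))) (Equivalence.from T-∨ (inj₂ arc))
    where
    arc : T ⌊ any? (arc-into? (reach v k) (proj₁ (D e))) ⌋
    arc = fromWitness (e , Pe , refl , head∈)

  reach-trail : ∀ {v} k {x} → T (reach v k x) →
    ∃ λ es → Trail D x v es × All (λ e → T (reach v k (proj₁ (D e)))) es
  reach-trail zero r = [] , toWitness r , []
  reach-trail {v} (suc k) {x} r with T? (reach v k x)
  ... | yes r′ = let es , trail , tails∈ = reach-trail k r′ in es , trail , All.map (reach-suc v k) tails∈
  ... | no x∉ with Equivalence.to T-∨ r
  ... | inj₁ r′  = ⊥-elim (x∉ r′)
  ... | inj₂ arc =
    let e , Pe , tail≡x , head∈ = toWitness arc
        es , trail , tails∈ = reach-trail k head∈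
        e∉es : e ∉ es
        e∉es e∈es = x∉ (subst (T ∘ reach v k) tail≡x (All.lookup tails∈ e∈es))
    in e ∷ es , (Pe , tail≡x , e∉es , trail) ,
       subst (T ∘ reach v (suc k)) (sym tail≡x) r ∷ All.map (reach-suc v k) tails∈

  trail-or-closed : ∀ v {Q : Fin n → Set} → Decidable Q →
    (∃ λ w → Q w × ∃ (Trail D w v)) ⊎ (∃ λ S → BackClosed S × T (S v) × ∀ x → T (S x) → ¬ Q x)
  trail-or-closed v Q? with chain-stabilises (reach v) (λ k _ → reach-suc v k)
  ... | k , stable with any? (λ w → T? (reach v k w) ×-dec Q? w)
  ... | yes (w , w∈ , Qw) = let es , trail , _ = reach-trail k w∈ in inj₁ (w , Qw , es , trail)
  ... | no none           =
    inj₂ (reach v k , reach-closed v k stable , reach-self v k , λ x x∈ Qx → none (x , x∈ , Qx))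

-- Cycles from backward walks

first-repeat : ∀ {n} (X : ℕ → Fin n) →
  ∃ λ b → ∃ λ a → a < b × X a ≡ X b × (∀ {p q} → p < q → q < b → X p ≢ X q)
first-repeat {n} X =
  let i , ¬¬repeats , earlier-fresh =
        ¬∀⟶∃¬-smallest (suc n) (λ i → ¬ Repeats (toℕ i)) (λ i → ¬? (repeats? (toℕ i))) some-repeat
      a , a<b , Xa≡Xb = decidable-stable (repeats? (toℕ i)) ¬¬repeats
  in toℕ i , a , a<b , Xa≡Xb , λ {p} {q} p<q q<b Xp≡Xq →
       earlier-fresh (fromℕ< q<b)
         (subst Repeats (sym (trans (toℕ-inject (fromℕ< q<b)) (toℕ-fromℕ< q<b))) (p , p<q , Xp≡Xq))
  where
  Repeats : ℕ → Set
  Repeats b = ∃ λ a → a < b × X a ≡ X b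

  repeats? : ∀ b → Dec (Repeats b)
  repeats? b = map′ (λ (a , eq) → toℕ a , toℕ<n a , eq)
                    (λ (a , a<b , eq) → fromℕ< a<b , trans (cong X (toℕ-fromℕ< a<b)) eq)
                    (any? λ (a : Fin b) → X (toℕ a) ≟ X b)

  some-repeat : ¬ (∀ i → ¬ Repeats (toℕ i))
  some-repeat none = let i , j , i<j , eq = pigeonhole (n<1+n n) (X ∘ toℕ) in none j (toℕ i , i<j , eq)

module BackwardWalk {n m} {G D : Ends n m} (loopless : Loopless G) (orient : IsOrientation G D)
  (P : Fin m → Set) (X : ℕ → Fin n) (E : ℕ → Fin m)
  (walk : ∀ k → P (E k) × D (E k) ≡ (X (suc k) , X k)) where

  head-of : ∀ k → proj₂ (D (E k)) ≡ X k
  head-of k = cong proj₂ (proj₂ (walk k))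

  segment-cycle : ∀ a k → 2 ≤ k → X a ≡ X (a + k) →
    (∀ {p q} → p < q → q < a + k → X p ≢ X q) → Cycle G P
  segment-cycle a k 2≤k closes distinct = k , 2≤k , vs , es , closes′ , vs-injective , es-injective , along
    where
    vs : Fin (suc k) → Fin n
    vs t = X (a + toℕ t)
    es : Fin k → Fin m
    es t = E (a + toℕ t)

    closes′ : vs zero ≡ vs (fromℕ k)
    closes′ = trans (cong X (+-identityʳ a)) (trans closes (cong (λ t → X (a + t)) (sym (toℕ-fromℕ k))))

    offsets-injective : ∀ {s t} → s < k → t < k → X (a + s) ≡ X (a + t) → s ≡ t
    offsets-injective {s} {t} s<k t<k eq with <-cmp s t
    ... | tri< s<t _ _ = ⊥-elim (distinct (+-monoʳ-< a s<t) (+-monoʳ-< a t<k) eq)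
    ... | tri≈ _ s≡t _ = s≡t
    ... | tri> _ _ t<s = ⊥-elim (distinct (+-monoʳ-< a t<s) (+-monoʳ-< a s<k) (sym eq))

    vs-injective : Injective _≡_ _≡_ (λ i → vs (inject₁ i))
    vs-injective {s} {t} eq = toℕ-injective (offsets-injective (toℕ<n s) (toℕ<n t)
      (subst₂ (λ p q → X (a + p) ≡ X (a + q)) (toℕ-inject₁ s) (toℕ-inject₁ t) eq))

    es-injective : Injective _≡_ _≡_ es
    es-injective {s} {t} eq = toℕ-injective (offsets-injective (toℕ<n s) (toℕ<n t)
      (trans (sym (head-of (a + toℕ s))) (trans (cong (proj₂ ∘ D) eq) (head-of (a + toℕ t)))))

    along : ∀ t → P (es t) × Joins G (es t) (vs (inject₁ t)) (vs (suc t))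
    along t = proj₁ (walk (a + toℕ t)) ,
      subst₂ (Joins G (es t))
        (trans (head-of (a + toℕ t)) (cong (λ p → X (a + p)) (sym (toℕ-inject₁ t))))
        (trans (cong proj₁ (proj₂ (walk (a + toℕ t)))) (cong X (sym (+-suc a (toℕ t)))))
        (arc-joins orient (es t))

  cycle : Cycle G P
  cycle with first-repeat X
  ... | b , a , a<b , Xa≡Xb , distinct with m≤n⇒∃[o]m+o≡n (<⇒≤ a<b)
  ... | zero        , refl = ⊥-elim (<-irrefl (sym (+-identityʳ a)) a<b)
  ... | suc zero    , refl = ⊥-elim (orientation-loopless loopless orient (E a)
        (trans (cong proj₁ (proj₂ (walk a))) (trans (cong X (+-comm 1 a)) (trans (sym Xa≡Xb) (sym (head-of a))))))
  ... | suc (suc _) , refl = segment-cycle a _ (s≤s (s≤s z≤n)) Xa≡Xb distinct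

in-arcs-cycle : ∀ {n m} {G D : Ends n m} → Loopless G → IsOrientation G D →
  (P : Fin m → Set) (S : Fin n → Bool) {v : Fin n} → T (S v) →
  (∀ x → T (S x) → ∃ λ e → P e × proj₂ (D e) ≡ x × T (S (proj₁ (D e)))) → Cycle G P
in-arcs-cycle {n} {m} {D = D} loopless orient P S {v} v∈S in-arc = BackwardWalk.cycle loopless orient P X E walk
  where
  position : ℕ → Σ (Fin n) (T ∘ S)
  position zero    = v , v∈S
  position (suc k) = let e , _ , _ , tail∈S = in-arc (proj₁ (position k)) (proj₂ (position k))
                     in proj₁ (D e) , tail∈S
  X : ℕ → Fin n
  X k = proj₁ (position k)
  E : ℕ → Fin m
  E k = proj₁ (in-arc (X k) (proj₂ (position k)))
  walk : ∀ k → P (E k) × D (E k) ≡ (X (suc k) , X k)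
  walk k = let _ , Pe , head≡x , _ = in-arc (X k) (proj₂ (position k)) in Pe , cong (X (suc k) ,_) head≡x

-- Balancing indegrees against capacities

module Balancing {n m : ℕ} (G : Ends n m) (P : Fin m → Bool) (c c′ : Fin n → ℕ) where
  open Trails {n} P
  open BackwardReach {n} P using (BackClosed; trail-or-closed; closed⇒indegIn≤outdegIn)

  Admissible : Ends n m → Set
  Admissible D = IsOrientation G D × (∀ x → outdegIn P D x ≤ c′ x)

  -- What remains when no vertex with spare capacity has a trail of P-arcs to the overloaded v.
  Blocking : Ends n m → (Fin n → Bool) → Fin n → Set
  Blocking D S v = BackClosed D S × T (S v) × (∀ x → T (S x) → c x ≤ indegIn P D x) × c v < indegIn P D v

  excess : Ends n m → ℕ
  excess D = sum λ x → indegIn P D x ∸ c x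

  unblocked-if-forest : Loopless G → IsForest G (T ∘ P) → (∀ x → 0 < c x) →
    ∀ D → Admissible D → ∀ S v → ¬ Blocking D S v
  unblocked-if-forest loopless forest c>0 D (orient , _) S v (closed , v∈S , saturated , _) =
    forest (in-arcs-cycle loopless orient (T ∘ P) S v∈S in-arc)
    where
    in-arc : ∀ x → T (S x) → ∃ λ e → T (P e) × proj₂ (D e) ≡ x × T (S (proj₁ (D e)))
    in-arc x x∈S =
      let e , arc = sum-ind-positive _ (≤-trans (c>0 x) (saturated x x∈S))
          Pe , head≡x = Equivalence.to T-∧ arc
      in e , Pe , toWitness head≡x , closed e Pe (subst (T ∘ S) (sym (toWitness head≡x)) x∈S)

  unblocked-if-c′≤c : (∀ x → c′ x ≤ c x) → ∀ D → Admissible D → ∀ S v → ¬ Blocking D S v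
  unblocked-if-c′≤c c′≤c D (_ , out≤) S v (closed , v∈S , saturated , over) = <-irrefl refl (begin-strict
    sum (λ x → ind (S x) * c x)
      <⟨ sum-mono-< (λ x → weighted (S x) (saturated x)) v (weighted-< (S v) v∈S over) ⟩
    sum (λ x → ind (S x) * indegIn P D x)
      ≤⟨ closed⇒indegIn≤outdegIn D {S} closed ⟩
    sum (λ x → ind (S x) * outdegIn P D x)
      ≤⟨ sum-mono-≤ (λ x → weighted (S x) (λ _ → ≤-trans (out≤ x) (c′≤c x))) ⟩
    sum (λ x → ind (S x) * c x) ∎)
    where
    open ≤-Reasoning
    weighted : ∀ b {p q} → (T b → p ≤ q) → ind b * p ≤ ind b * q
    weighted true  p≤q = *-monoʳ-≤ 1 (p≤q _)
    weighted false _   = z≤n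
    weighted-< : ∀ b {p q} → T b → p < q → ind b * p < ind b * q
    weighted-< true _ p<q = *-monoʳ-< 1 p<q

  module _ (loopless : Loopless G) (degree≤ : ∀ x → degreeIn P G x ≤ c x + c′ x)
           (unblocked : ∀ D → Admissible D → ∀ S v → ¬ Blocking D S v) where

    improve : ∀ D → Admissible D → ∀ {v} → c v < indegIn P D v →
      Σ (Ends n m) λ D′ → Admissible D′ × excess D′ < excess D
    improve D (orient , out≤) {v} over
      with trail-or-closed D v (λ w → indegIn P D w <? c w)
    ... | inj₂ (S , closed , v∈S , saturated) =
      ⊥-elim (unblocked D (orient , out≤) S v (closed , v∈S , (λ x x∈S → ≮⇒≥ (saturated x x∈S)) , over))
    ... | inj₁ (w , under , es , trail) =
      D′ , (reverseAlong-orientation es orient , out′≤) ,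
      sum-mono-< excess′≤ v excess′<at-v
      where
      D′ : Ends n m
      D′ = reverseAlong es D
      w≢v : w ≢ v
      w≢v refl = <-asym under over

      in-moved : UnitMoved (indegIn P D′) (indegIn P D) v w
      in-moved = δ-balance⇒unitMoved w≢v (λ y → proj₁ (reverseAlong-degrees es trail y))
      out-moved : UnitMoved (outdegIn P D′) (outdegIn P D) w v
      out-moved = δ-balance⇒unitMoved (w≢v ∘ sym) (λ y → proj₂ (reverseAlong-degrees es trail y))
      module In  = UnitMoved in-moved
      module Out = UnitMoved out-moved

      excess′<at-v : indegIn P D′ v ∸ c v < indegIn P D v ∸ c v
      excess′<at-v = ∸-monoˡ-< (≤-reflexive In.at-source) (≤-pred (subst (c v <_) (sym In.at-source) over))

      excess′≤ : ∀ y → indegIn P D′ y ∸ c y ≤ indegIn P D y ∸ c y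
      excess′≤ y with y ≟ v | y ≟ w
      ... | yes refl | _        = <⇒≤ excess′<at-v
      ... | no _     | yes refl =
        ≤-trans (≤-reflexive (m≤n⇒m∸n≡0 (subst (_≤ c w) (sym In.at-target) under))) z≤n
      ... | no y≢v   | no y≢w   = ≤-reflexive (cong (_∸ c y) (In.elsewhere y y≢v y≢w))

      out′≤ : ∀ y → outdegIn P D′ y ≤ c′ y
      out′≤ y with y ≟ v
      ... | yes refl = subst (_≤ c′ v) (sym Out.at-target) (+-cancelˡ-≤ (c v) _ _ (begin
          c v + suc (outdegIn P D v)           ≡⟨ +-suc (c v) _ ⟩
          suc (c v) + outdegIn P D v           ≤⟨ +-monoˡ-≤ _ over ⟩
          indegIn P D v + outdegIn P D v       ≡⟨ indegIn+outdegIn≡degreeIn loopless orient P v ⟩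
          degreeIn P G v                       ≤⟨ degree≤ v ⟩
          c v + c′ v                           ∎))
        where open ≤-Reasoning
      ... | no y≢v   = ≤-trans (out′≤out y y≢v) (out≤ y)
        where
        out′≤out : ∀ y → y ≢ v → outdegIn P D′ y ≤ outdegIn P D y
        out′≤out y y≢v with y ≟ w
        ... | yes refl = ≤-trans (n≤1+n _) (≤-reflexive Out.at-source)
        ... | no y≢w   = ≤-reflexive (Out.elsewhere y y≢w y≢v)

    balance : ∀ k D → Admissible D → excess D ≤ k →
      Σ (Ends n m) λ D′ → Admissible D′ × (∀ x → indegIn P D′ x ≤ c x)
    balance k D admissible excess≤k with any? (λ x → c x <? indegIn P D x)
    ... | no fits = D , admissible , λ x → ≮⇒≥ (fits ∘ (x ,_))
    ... | yes (v , over) with improve D admissible over | k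
    ...   | _ , _ , drops | zero = ⊥-elim (n≮0 (≤-trans drops excess≤k))
    ...   | D′ , admissible′ , drops | suc k′ =
      balance k′ D′ admissible′ (≤-pred (≤-trans drops excess≤k))

    balanced-orientation : ∀ D → Admissible D →
      Σ (Ends n m) λ D′ → Admissible D′ × (∀ x → indegIn P D′ x ≤ c x)
    balanced-orientation D admissible = balance (excess D) D admissible ≤-refl

-- Orientations with bounded in- and outdegrees

forest-orientation : ∀ {n m} {G : Ends n m} → Loopless G → (F : Fin m → Bool) → IsForest G (T ∘ F) →
  Σ (Ends n m) λ D → IsOrientation G D × (∀ x → indegIn F D x ≤ 1)
forest-orientation {G = G} loopless F forest =
  let D , (orient , _) , indeg≤1 =
        balanced-orientation loopless (λ x → n≤1+n _) (unblocked-if-forest loopless forest (λ _ → s≤s z≤n))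
          G (G-orientation , outdegIn≤degreeIn loopless G-orientation F)
  in D , orient , indeg≤1
  where
  -- Taking c′ to be the degree makes the outdegree constraint vacuous.
  open Balancing G F (λ _ → 1) (degreeIn F G)
  G-orientation : IsOrientation G G
  G-orientation _ = inj₁ refl

indeg-by-classes : ∀ {n m d} (colour : Fin m → Fin d) (D : Ends n m) x →
  indeg D x ≡ sum (λ i → indegIn (λ e → ⌊ colour e ≟ i ⌋) D x)
indeg-by-classes colour D x = begin
  indeg D x
    ≡⟨ indeg≡indegIn D x ⟩
  sum (λ e → ind ⌊ proj₂ (D e) ≟ x ⌋)
    ≡⟨ sum-cong-≗ (λ e →
         trans (sym (sum-δ (colour e) _)) (sum-cong-≗ (λ i → sym (ind-∧ ⌊ colour e ≟ i ⌋ _)))) ⟩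
  sum (λ e → sum (λ i → ind (⌊ colour e ≟ i ⌋ ∧ ⌊ proj₂ (D e) ≟ x ⌋)))
    ≡⟨ ∑-comm (λ e i → ind (⌊ colour e ≟ i ⌋ ∧ ⌊ proj₂ (D e) ≟ x ⌋)) ⟩
  sum (λ i → indegIn (λ e → ⌊ colour e ≟ i ⌋) D x) ∎
  where open ≡-Reasoning

arboricity⇒indeg-orientation : ∀ {n m d} {G : Ends n m} → Loopless G → ArboricityAtMost G d →
  Σ (Ends n m) λ D → IsOrientation G D × (∀ x → indeg D x ≤ d)
arboricity⇒indeg-orientation {n} {m} {d} {G} loopless (colour , forest) = D , orient , indeg≤d
  where
  class : Fin d → Fin m → Bool
  class i e = ⌊ colour e ≟ i ⌋

  oriented : ∀ i → Σ (Ends n m) λ Dᵢ → IsOrientation G Dᵢ × (∀ x → indegIn (class i) Dᵢ x ≤ 1)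
  oriented i = forest-orientation loopless (class i)
    (forest i ∘ cycle-map {H = G} (λ {e} → toWitness {a? = colour e ≟ i}) (λ _ → id))

  -- The colour classes are disjoint, so their orientations combine arc by arc.
  D : Ends n m
  D e = proj₁ (oriented (colour e)) e

  orient : IsOrientation G D
  orient e = proj₁ (proj₂ (oriented (colour e))) e

  same-in-class : ∀ i x → indegIn (class i) D x ≡ indegIn (class i) (proj₁ (oriented i)) x
  same-in-class i x = sum-cong-≗ arc
    where
    arc : ∀ e → ind (class i e ∧ ⌊ proj₂ (D e) ≟ x ⌋)
              ≡ ind (class i e ∧ ⌊ proj₂ (proj₁ (oriented i) e) ≟ x ⌋)
    arc e with colour e ≟ i
    ... | yes refl = refl
    ... | no _     = refl

  indeg≤d : ∀ x → indeg D x ≤ d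
  indeg≤d x = begin
    indeg D x
      ≡⟨ indeg-by-classes colour D x ⟩
    sum (λ i → indegIn (class i) D x)
      ≤⟨ sum-mono-≤ (λ i → ≤-trans (≤-reflexive (same-in-class i x)) (proj₂ (proj₂ (oriented i)) x)) ⟩
    sum {d} (λ _ → 1)
      ≡⟨ trans (sum-const d 1) (*-identityʳ d) ⟩
    d ∎
    where open ≤-Reasoning

bounded-orientation : ∀ {n m d} {G D : Ends n m} (c : Fin n → ℕ) → Loopless G → (∀ x → d ≤ c x) →
  (∀ x → degree G x ≤ c x + d) → IsOrientation G D → (∀ x → indeg D x ≤ d) →
  Σ (Ends n m) λ D′ → IsOrientation G D′ × (∀ x → indeg D′ x ≤ d) × (∀ x → outdeg D′ x ≤ c x)
bounded-orientation {d = d} {G} {D} c loopless d≤c degree≤ orient indeg≤d =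
  let D′ , (orient′ , outdeg′≤d) , indeg′≤c =
        balanced-orientation loopless degreeIn≤ (unblocked-if-c′≤c d≤c)
          (reverse D) (reverse-orientation orient , λ x → subst (_≤ d) (indeg≡indegIn D x) (indeg≤d x))
  in reverse D′ , reverse-orientation orient′ ,
     (λ x → subst (_≤ d) (sym (indeg≡indegIn (reverse D′) x)) (outdeg′≤d x)) ,
     (λ x → subst (_≤ c x) (sym (outdeg≡outdegIn (reverse D′) x)) (indeg′≤c x))
  where
  open Balancing G allEdges c (λ _ → d)
  degreeIn≤ : ∀ x → degreeIn allEdges G x ≤ c x + d
  degreeIn≤ x = subst (_≤ c x + d) (degree≡degreeIn G x) (degree≤ x)

Δf≤d⇒degree≤ : ∀ {n m} {G : Ends n m} {f : Fin n → ℕ} {d} → (∀ x → 0 < f x) → Δf G f ≤ d →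
  ∀ x → degree G x ≤ d * (f x ∸ 1) + d
Δf≤d⇒degree≤ {G = G} {f} {d} f>0 Δf≤d x = begin
  degree G x              ≤⟨ ceilDiv≤d⇒a≤d*b {degree G x} {f x} (f>0 x) ceilDiv≤d ⟩
  d * f x                 ≡⟨ cong (d *_) (m∸n+n≡m (f>0 x)) ⟨
  d * (f x ∸ 1 + 1)       ≡⟨ *-distribˡ-+ d (f x ∸ 1) 1 ⟩
  d * (f x ∸ 1) + d * 1   ≡⟨ cong (d * (f x ∸ 1) +_) (*-identityʳ d) ⟩
  d * (f x ∸ 1) + d       ∎
  where
  open ≤-Reasoning
  ceilDiv≤d : ceilDiv (degree G x) (f x) ≤ d
  ceilDiv≤d = maxOver≤⇒≤ (λ x → ceilDiv (degree G x) (f x)) Δf≤d x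

corollary14 : ∀ {n m} (G : Ends n m) → Loopless G →
    (f : Fin n → ℕ) → (∀ v → 2 ≤ f v) → (d : ℕ) →
    Δf G f ≤ d → ArboricityAtMost G d →
    Σ (Ends n m) λ D →
      IsOrientation G D × Δin D ≤ d × Δout-f-1 D f ≤ d × ArboricityAtMost D d
corollary14 G loopless f 2≤f d Δf≤d arboricity =
  let D₁ , orient₁ , indeg₁≤d = arboricity⇒indeg-orientation loopless arboricity
      D , orient , indeg≤d , outdeg≤ =
        bounded-orientation (λ x → d * (f x ∸ 1)) loopless d≤d*[f-1]
          (Δf≤d⇒degree≤ {G = G} {f} (λ x → ≤-trans (s≤s z≤n) (2≤f x)) Δf≤d) orient₁ indeg₁≤d
  in D , orient , ≤⇒maxOver≤ (indeg D) indeg≤d ,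
     ≤⇒maxOver≤ (λ x → ceilDiv (outdeg D x) (f x ∸ 1)) (λ x → a≤d*b⇒ceilDiv≤d (0<f-1 x) (outdeg≤ x)) ,
     orientation-arboricity orient arboricity
  where
  0<f-1 : ∀ x → 0 < f x ∸ 1
  0<f-1 x = ∸-monoˡ-≤ 1 (2≤f x)

  d≤d*[f-1] : ∀ x → d ≤ d * (f x ∸ 1)
  d≤d*[f-1] x = ≤-trans (≤-reflexive (sym (*-identityʳ d))) (*-monoʳ-≤ d (0<f-1 x))
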